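{- Let $k\ge 1$ and $n\ge 1$ be integers, let $p$ be a prime dividing $k+1$, and let $e=\nu_p(k+1)\ge 1$. (a) If $k+1\ne p^e$, then $\nu_p\big((n-1)^{\underline{k}}\big)\ge e$. (b) If $k+1=p^e$, then $\nu_p\big((n-1)^{\underline{k}}\big)\ge e-1$, and equality holds only if $p\mid n$. (c) $\nu_p\big((n-1)^{\underline{k}}/(k+1)\big)<0$ if and only if $k+1\in\{4,p\}$ and $(k+1)\mid n$; in this case $\nu_p\big((n-1)^{\underline{k}}/(k+1)\big)=-1$.
   Context: For integers $m$ and $k\ge 1$, the falling factorial is $m^{\underline{k}}=m(m-1)\cdots(m-k+1)$ (it is $0$ when $0\le m<k$). For a prime $p$ and a nonzero integer $m$, $\nu_p(m)$ is the exponent of the largest power of $p$ dividing $m$; this extends to nonzero rationals by $\nu_p(r/s)=\nu_p(r)-\nu_p(s)$, and (standard convention) $\nu_p(0)=+\infty$. -}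

module Defs where

open import Data.Nat using (ℕ; zero; suc; _+_; _*_; _∸_; _≤_; _<_)
open import Data.Nat.DivMod using (_/_)
open import Data.Nat.Divisibility using (_∣?_)
open import Data.Integer as ℤ using (ℤ; +_; _-_)
open import Relation.Nullary using (yes; no)

-- ℕ ∪ {+∞}, used for p-adic valuations of natural numbers (ν_p(0) = +∞).
data ℕ∞ : Set where
  fin : ℕ → ℕ∞
  ∞   : ℕ∞

-- ℤ ∪ {+∞}, used for p-adic valuations of rationals (ν_p(0) = +∞).
data ℤ∞ : Set where
  fin : ℤ → ℤ∞
  ∞   : ℤ∞

data _≤∞_ : ℕ∞ → ℕ∞ → Set where
  fin≤fin : ∀ {a b} → a ≤ b → fin a ≤∞ fin b
  _≤∞-top : ∀ x → x ≤∞ ∞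

data _<ℤ∞_ : ℤ∞ → ℤ∞ → Set where
  fin<fin : ∀ {a b} → a ℤ.< b → fin a <ℤ∞ fin b
  fin<∞   : ∀ {a} → fin a <ℤ∞ ∞

-- Exponent of p in m (for m ≥ 1, p ≥ 2), computed by repeated division
-- with a fuel argument (fuel m suffices since m / p < m).
νAux : ℕ → ℕ → ℕ → ℕ
νAux zero     p               m = 0
νAux (suc f)  zero            m = 0
νAux (suc f)  (suc zero)      m = 0
νAux (suc f)  (suc (suc q))   m with suc (suc q) ∣? m
... | yes _ = suc (νAux f (suc (suc q)) (m / suc (suc q)))
... | no  _ = 0

ν : ℕ → ℕ → ℕ∞
ν p zero    = ∞
ν p (suc m) = fin (νAux (suc m) p (suc m))

-- ν_p of the rational a / b (b ≠ 0), via ν_p(a/b) = ν_p(a) - ν_p(b);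
-- equals +∞ when a = 0.
νfrac : ℕ → ℕ → ℕ → ℤ∞
νfrac p zero    b = ∞
νfrac p (suc a) b = fin (+ νAux (suc a) p (suc a) - + νAux b p b)

-- For X = (n-1)^(k), k! ∣ X and (k+1)! ∣ nX. A proper divisor of k+1 divides
-- k!, which gives (a) and the first half of (b); if p ∤ n, cancelling n from
-- p^e ∣ nX gives the second half. A negative value in (c) means p^e ∤ X, so by
-- (a) and (b) k+1 = p^e with p ∣ n; apart from k+1 ∈ {p, 4} one has
-- e ≤ p^(e-1) - 1, whence p^e ∣ p^(p^(e-1)-1) ∣ (p^e - p)! ∣ k! ∣ X. In the two
-- remaining cases p^e ∤ X is decided by looking at the factors of X.
module Submission where

open import Defs
open import Data.Nat using (ℕ; suc; _∸_; _≤_; _^_)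
open import Data.Nat.Combinatorics using (_P_)
open import Data.Nat.Divisibility using (_∣_)
open import Data.Nat.Primality using (Prime)
open import Data.Integer using (+_; -[1+_])
open import Data.Product using (_×_)
open import Data.Sum using (_⊎_)
open import Relation.Binary.PropositionalEquality using (_≡_; _≢_)
open import Function.Bundles using (_⇔_)

open import Data.Nat
open import Data.Nat.Properties
open import Data.Nat.Combinatorics.Base using (_P′_)
open import Data.Nat.Combinatorics.Specification
  using (nP′k≡n!/[n∸k]!; nPk≡n!/[n∸k]!; k>n⇒nPk≡0; k!∣nP′k; nP′k≡n[n∸1P′k∸1])
open import Data.Nat.Divisibility
open import Data.Nat.DivMod using (_%_; _/_; m≡m%n+[m/n]*n; m%n<n; m*n/n≡m)
open import Data.Nat.Primality using (euclidsLemma; prime⇒nonZero; prime⇒nonTrivial; prime[2])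
import Data.Integer as ℤ
import Data.Integer.Properties as ℤ
open import Data.Product using (_,_; proj₁; proj₂)
open import Data.Sum using (inj₁; inj₂; reduce)
open import Function using (_∘_)
open import Function.Bundles using (mk⇔; module Equivalence)
open import Relation.Nullary using (¬_; yes; no; contradiction)
open import Relation.Nullary.Decidable using (decidable-stable; from-no)
open import Relation.Binary.PropositionalEquality
  using (refl; sym; trans; cong; subst; subst₂; module ≡-Reasoning)

open Equivalence using (to; from)

prime>1 : ∀ {p} → Prime p → 1 < p
prime>1 {p} pp = nonTrivial⇒n>1 p {{prime⇒nonTrivial pp}}

∣1+n∧≢⇒∣n! : ∀ {d n} → d ∣ suc n → d ≢ suc n → d ∣ n !
∣1+n∧≢⇒∣n! {zero}  0∣1+n _ = contradiction (0∣⇒≡0 0∣1+n) λ ()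
∣1+n∧≢⇒∣n! {suc d} d∣1+n d≢1+n =
  ∣-trans (m∣m*n (d !)) (m≤n⇒m!∣n! (s≤s⁻¹ (≤∧≢⇒< (∣⇒≤ d∣1+n) d≢1+n)))

^-monoʳ-∣ : ∀ p {m n} → m ≤ n → p ^ m ∣ p ^ n
^-monoʳ-∣ p {m} {n} m≤n = subst (p ^ m ∣_)
  (trans (sym (^-distribˡ-+-* p m (n ∸ m))) (cong (p ^_) (m+[n∸m]≡n m≤n)))
  (m∣m*n (p ^ (n ∸ m)))

p^c∣[c*p]! : ∀ p c → .{{NonZero p}} → p ^ c ∣ (c * p) !
p^c∣[c*p]! (suc _)   zero    = ∣-refl
p^c∣[c*p]! p@(suc q) (suc c) =
  *-pres-∣ (n∣m*n (suc c) {p}) (∣-trans (p^c∣[c*p]! p c) (m≤n⇒m!∣n! (m≤n+m (c * p) q)))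

[m∸1]*n≤m*n∸1 : ∀ m n → 1 ≤ n → (m ∸ 1) * n ≤ m * n ∸ 1
[m∸1]*n≤m*n∸1 m n 1≤n = begin
  (m ∸ 1) * n   ≡⟨ *-distribʳ-∸ n m 1 ⟩
  m * n ∸ 1 * n ≤⟨ ∸-monoʳ-≤ (m * n) (≤-trans 1≤n (≤-reflexive (sym (*-identityˡ n)))) ⟩
  m * n ∸ 1     ∎
  where open ≤-Reasoning

p^[1+e]∣k! : ∀ {p e k} → 2 ≤ p → suc k ≡ p ^ suc e → 2 + e ≤ p ^ e → p ^ suc e ∣ k !
p^[1+e]∣k! {p} {e} {k} 2≤p k+1≡p^[1+e] 2+e≤p^e = begin
  p ^ suc e  ∣⟨ ^-monoʳ-∣ p (∸-monoˡ-≤ 1 2+e≤p^e) ⟩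
  p ^ c      ∣⟨ p^c∣[c*p]! p c ⟩
  (c * p) !  ∣⟨ m≤n⇒m!∣n! c*p≤k ⟩
  k !        ∎
  where
  open ∣-Reasoning
  instance _ = >-nonZero (≤-trans (s≤s z≤n) 2≤p)
  c = p ^ e ∸ 1
  c*p≤k : c * p ≤ k
  c*p≤k = subst (c * p ≤_) (cong (_∸ 1) (trans (*-comm (p ^ e) p) (sym k+1≡p^[1+e])))
    ([m∸1]*n≤m*n∸1 (p ^ e) p (≤-trans (s≤s z≤n) 2≤p))

2+n≤2^n : ∀ n → 2 ≤ n → 2 + n ≤ 2 ^ n
2+n≤2^n (suc zero)          (s≤s ())
2+n≤2^n (suc (suc zero))    _ = ≤-refl
2+n≤2^n (suc n@(suc (suc _))) _ = step (2+n≤2^n n (s≤s (s≤s z≤n)))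
  where
  step : 2 + n ≤ 2 ^ n → 3 + n ≤ 2 ^ suc n
  step ih = begin
    1 + (2 + n)        ≤⟨ +-monoˡ-≤ (2 + n) {1} {2 + n} (s≤s z≤n) ⟩
    (2 + n) + (2 + n)  ≤⟨ +-mono-≤ ih ih ⟩
    2 ^ n + 2 ^ n      ≡⟨ cong (_+_ (2 ^ n)) (sym (+-identityʳ (2 ^ n))) ⟩
    2 ^ suc n          ∎
    where open ≤-Reasoning

p^e∣m*n∧p∤m⇒p^e∣n : ∀ {p m} e n → Prime p → ¬ p ∣ m → p ^ e ∣ m * n → p ^ e ∣ n
p^e∣m*n∧p∤m⇒p^e∣n zero n _ _ _ = 1∣ n
p^e∣m*n∧p∤m⇒p^e∣n {p} {m} (suc e) n pp p∤m p^[1+e]∣mn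
  with euclidsLemma m n pp (∣-trans (m∣m*n (p ^ e)) p^[1+e]∣mn)
... | inj₁ p∣m = contradiction p∣m p∤m
... | inj₂ (divides n′ refl) =
  subst (_∣ n′ * p) (*-comm (p ^ e) p) (*-monoˡ-∣ p (p^e∣m*n∧p∤m⇒p^e∣n e n′ pp p∤m p^e∣mn′))
  where
  instance _ = prime⇒nonZero pp
  p^e∣mn′ : p ^ e ∣ m * n′
  p^e∣mn′ = *-cancelʳ-∣ p (subst₂ _∣_ (*-comm p (p ^ e)) (sym (*-assoc m n′ p)) p^[1+e]∣mn)

nP′k≡0 : ∀ {n k} → n < k → n P′ k ≡ 0
nP′k≡0 {n} {suc k} (s≤s n≤k) = cong (_* (n P′ k)) (m≤n⇒m∸n≡0 n≤k)

nPk≡nP′k : ∀ n k → n P k ≡ n P′ k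
nPk≡nP′k n k with k ≤? n
... | yes k≤n = trans (nPk≡n!/[n∸k]! k≤n) (sym (nP′k≡n!/[n∸k]! k≤n))
... | no  k≰n = trans (k>n⇒nPk≡0 (≰⇒> k≰n)) (sym (nP′k≡0 (≰⇒> k≰n)))

∣k!⇒∣nP′k : ∀ {d} n k → d ∣ k ! → d ∣ n P′ k
∣k!⇒∣nP′k n k d∣k! with k ≤? n
... | yes k≤n = ∣-trans d∣k! (k!∣nP′k k≤n)
... | no  k≰n = subst (_ ∣_) (sym (nP′k≡0 (≰⇒> k≰n))) (_ ∣0)

∣1+k∧≢⇒∣nP′k : ∀ {d} n k → d ∣ suc k → d ≢ suc k → d ∣ n P′ k
∣1+k∧≢⇒∣nP′k n k d∣1+k d≢1+k = ∣k!⇒∣nP′k n k (∣1+n∧≢⇒∣n! d∣1+k d≢1+k)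

∣1+k∧∤nP′k⇒≡1+k : ∀ {d k} n → d ∣ suc k → ¬ d ∣ n P′ k → d ≡ suc k
∣1+k∧∤nP′k⇒≡1+k {d} {k} n d∣1+k d∤X = decidable-stable (d ≟ suc k) (d∤X ∘ ∣1+k∧≢⇒∣nP′k n k d∣1+k)

1+k∣[1+n]*nP′k : ∀ n k → suc k ∣ suc n * (n P′ k)
1+k∣[1+n]*nP′k n k = subst (suc k ∣_) (nP′k≡n[n∸1P′k∸1] (suc n) (suc k))
  (∣k!⇒∣nP′k (suc n) (suc k) (m∣m*n (k !)))

p∤nP′k : ∀ {p} n k → Prime p → (∀ i → i < k → ¬ p ∣ n ∸ i) → ¬ p ∣ n P′ k
p∤nP′k n zero    pp _ p∣1 = <⇒≱ (prime>1 pp) (∣⇒≤ p∣1)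
p∤nP′k n (suc k) pp p∤n∸i p∣nP′[1+k] with euclidsLemma (n ∸ k) (n P′ k) pp p∣nP′[1+k]
... | inj₁ p∣n∸k  = p∤n∸i k (n<1+n k) p∣n∸k
... | inj₂ p∣nP′k = p∤nP′k n k pp (λ i i<k → p∤n∸i i (m<n⇒m<1+n i<k)) p∣nP′k

p∤nP′[p∸1] : ∀ {p k} n → Prime p → suc k ≡ p → p ∣ suc n → ¬ p ∣ n P′ k
p∤nP′[p∸1] {k = k} n pp refl p∣1+n = p∤nP′k n k pp p∤n∸i
  where
  p∤n∸i : ∀ i → i < k → ¬ suc k ∣ n ∸ i
  p∤n∸i i i<k p∣n∸i = <⇒≱ (s≤s i<k) (∣⇒≤ p∣1+i)
    where
    i≤n : i ≤ n
    i≤n = ≤-trans (<⇒≤ i<k) (s≤s⁻¹ (∣⇒≤ p∣1+n))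
    p∣1+i : suc k ∣ suc i
    p∣1+i = ∣m+n∣m⇒∣n (subst (suc k ∣_) (sym (m∸n+n≡m (s≤s i≤n))) p∣1+n) p∣n∸i

∣m+k*n∣n⇒∣m : ∀ {d} m k n → d ∣ m + k * n → d ∣ n → d ∣ m
∣m+k*n∣n⇒∣m {d} m k n d∣m+kn d∣n = ∣m+n∣m⇒∣n (subst (d ∣_) (+-comm m (k * n)) d∣m+kn) (∣n⇒∣m*n k d∣n)

2∣1+n⇒4∣1+n⊎4∣nP′3 : ∀ n → 2 ∣ suc n → 4 ∣ suc n ⊎ 4 ∣ n P′ 3
2∣1+n⇒4∣1+n⊎4∣nP′3 n 2∣1+n with suc n % 4 | m≡m%n+[m/n]*n (suc n) 4 | m%n<n (suc n) 4
... | 0 | 1+n≡4q   | _ = inj₁ (divides q 1+n≡4q)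
  where q = suc n / 4
... | 1 | 1+n≡1+4q | _ = contradiction (∣m+k*n∣n⇒∣m 1 q 4 (subst (2 ∣_) 1+n≡1+4q 2∣1+n) (divides 2 refl))
                                      (from-no (2 ∣? 1))
  where q = suc n / 4
... | 2 | 1+n≡2+4q | _ = inj₂ (subst (λ n → 4 ∣ n P′ 3) (sym (suc-injective 1+n≡2+4q))
                                 (∣n⇒∣m*n (q * 4 ∸ 1) (∣m⇒∣m*n (suc (q * 4) * 1) (n∣m*n q))))
  where q = suc n / 4
... | 3 | 1+n≡3+4q | _ = contradiction (∣m+k*n∣n⇒∣m 3 q 4 (subst (2 ∣_) 1+n≡3+4q 2∣1+n) (divides 2 refl))
                                      (from-no (2 ∣? 3))
  where q = suc n / 4
... | suc (suc (suc (suc _))) | _ | s≤s (s≤s (s≤s (s≤s ())))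

-- With 1+n = 4(r+1), n^(3) = (4r+3)(4r+2)(4r+1) is twice an odd number.
4∣1+n⇒4∤nP′3 : ∀ n → 4 ∣ suc n → ¬ 4 ∣ n P′ 3
4∣1+n⇒4∤nP′3 n (divides zero ())
4∣1+n⇒4∤nP′3 .(3 + r * 4) (divides (suc r) refl) 4∣X =
  from-no (4 ∣? 2) (∣m+k*n∣n⇒∣m 2 r 4 4∣4r+2 ∣-refl)
  where
  odd : ∀ s → ¬ 2 ∣ s → ¬ 2 ∣ s + r * 4
  odd s 2∤s 2∣s+4r = 2∤s (∣m+k*n∣n⇒∣m s r 4 2∣s+4r (divides 2 refl))
  4∣[4r+2]*[4r+3] : 4 ∣ (2 + r * 4) * ((3 + r * 4) * 1)
  4∣[4r+2]*[4r+3] = p^e∣m*n∧p∤m⇒p^e∣n 2 _ prime[2] (odd 1 (from-no (2 ∣? 1))) 4∣X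
  4∣4r+2 : 4 ∣ 2 + r * 4
  4∣4r+2 = p^e∣m*n∧p∤m⇒p^e∣n 2 _ prime[2] (odd 3 (from-no (2 ∣? 3)))
    (subst (4 ∣_) (trans (cong ((2 + r * 4) *_) (*-identityʳ (3 + r * 4)))
                         (*-comm (2 + r * 4) (3 + r * 4)))
      4∣[4r+2]*[4r+3])

νAux-spec : ∀ q f m a → 1 ≤ m → m ≤ f → suc (suc q) ^ a ∣ m ⇔ a ≤ νAux f (suc (suc q)) m
νAux-spec q zero    m a 1≤m m≤0 = contradiction (≤-trans 1≤m m≤0) λ ()
νAux-spec q (suc f) m zero _ _   = mk⇔ (λ _ → z≤n) (λ _ → 1∣ m)
νAux-spec q (suc f) m (suc a) 1≤m m≤1+f with suc (suc q) ∣? m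
... | no p∤m = mk⇔ (λ p^[1+a]∣m → contradiction (∣-trans (m∣m*n (suc (suc q) ^ a)) p^[1+a]∣m) p∤m) λ ()
... | yes (divides zero refl) = contradiction 1≤m λ ()
... | yes (divides m′@(suc _) refl) rewrite m*n/n≡m m′ (suc (suc q)) {{_}} = mk⇔
  (λ p^[1+a]∣m′p → s≤s (to ih (*-cancelʳ-∣ p (subst (_∣ m′ * p) (*-comm p (p ^ a)) p^[1+a]∣m′p))))
  (λ 1+a≤1+ν → subst (_∣ m′ * p) (*-comm (p ^ a) p) (*-monoˡ-∣ p (from ih (s≤s⁻¹ 1+a≤1+ν))))
  where
  p = suc (suc q)
  ih : p ^ a ∣ m′ ⇔ a ≤ νAux f p m′
  ih = νAux-spec q f m′ a (s≤s z≤n) (s≤s⁻¹ (≤-trans (m<m*n m′ p (s≤s (s≤s z≤n))) m≤1+f))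

≤ν⇔^∣ : ∀ {p} → 2 ≤ p → ∀ a n → fin a ≤∞ ν p n ⇔ p ^ a ∣ n
≤ν⇔^∣ (s≤s (s≤s _)) a zero    = mk⇔ (λ _ → _ ∣0) (λ _ → _ ≤∞-top)
≤ν⇔^∣ (s≤s (s≤s {n = q} _)) a (suc n) =
  mk⇔ (λ { (fin≤fin a≤ν) → from spec a≤ν }) (fin≤fin ∘ to spec)
  where spec = νAux-spec q (suc n) (suc n) a (s≤s z≤n) ≤-refl

ν≡fin⇔ : ∀ {p} → 2 ≤ p → ∀ a n → ν p n ≡ fin a ⇔ (p ^ a ∣ n × ¬ p ^ suc a ∣ n)
ν≡fin⇔ {p} 2≤p a n = mk⇔ to′ from′
  where
  to′ : ν p n ≡ fin a → p ^ a ∣ n × ¬ p ^ suc a ∣ n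
  to′ νn≡a = to (≤ν⇔^∣ 2≤p a n) (subst (fin a ≤∞_) (sym νn≡a) (fin≤fin ≤-refl))
           , λ p^[1+a]∣n → 1+a≰a (subst (fin (suc a) ≤∞_) νn≡a (from (≤ν⇔^∣ 2≤p (suc a) n) p^[1+a]∣n))
    where
    1+a≰a : ¬ fin (suc a) ≤∞ fin a
    1+a≰a (fin≤fin 1+a≤a) = <-irrefl refl 1+a≤a
  from′ : p ^ a ∣ n × ¬ p ^ suc a ∣ n → ν p n ≡ fin a
  from′ (p^a∣n , p^[1+a]∤n) with ν p n | from (≤ν⇔^∣ 2≤p a n) p^a∣n | ≤ν⇔^∣ 2≤p (suc a) n
  ... | ∞     | _            | spec = contradiction (to spec (_ ≤∞-top)) p^[1+a]∤n
  ... | fin v | fin≤fin a≤v | spec =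
    cong fin (≤-antisym (s≤s⁻¹ (≰⇒> (p^[1+a]∤n ∘ to spec ∘ fin≤fin))) a≤v)

νfrac≡ : ∀ p a b {u v} → ν p (suc a) ≡ fin u → ν p (suc b) ≡ fin v →
         νfrac p (suc a) (suc b) ≡ fin (+ u ℤ.- + v)
νfrac≡ p a b refl refl = refl

+m-+[1+m]≡-1 : ∀ m → + m ℤ.- + suc m ≡ -[1+ 0 ]
+m-+[1+m]≡-1 m = begin
  + m ℤ.- + suc m    ≡⟨ ℤ.[+m]-[+n]≡m⊖n m (suc m) ⟩
  m ℤ.⊖ suc m        ≡⟨ ℤ.⊖-< (n<1+n m) ⟩
  ℤ.- + (suc m ∸ m)  ≡⟨ cong (λ d → ℤ.- + d) (m+n∸n≡m 1 m) ⟩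
  -[1+ 0 ]           ∎
  where open ≡-Reasoning

+m-+n≮0 : ∀ {m n} → n ≤ m → ¬ (+ m ℤ.- + n ℤ.< + 0)
+m-+n≮0 {m} {n} n≤m = ℤ.+≮0 ∘ subst (ℤ._< + 0) (trans (ℤ.[+m]-[+n]≡m⊖n m n) (ℤ.⊖-≥ n≤m))

νfrac<0⇒¬^∣ : ∀ {p e} n k → 2 ≤ p → ν p (suc k) ≡ fin e →
              νfrac p n (suc k) <ℤ∞ fin (+ 0) → ¬ p ^ e ∣ n
νfrac<0⇒¬^∣ {p} {e} (suc n) k 2≤p νk≡e νfrac<0 p^e∣n
  with ν p (suc n) in νn≡v | from (≤ν⇔^∣ 2≤p e (suc n)) p^e∣n
... | fin v | fin≤fin e≤v with subst (_<ℤ∞ fin (+ 0)) (νfrac≡ p n k νn≡v νk≡e) νfrac<0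
...   | fin<fin v-e<0 = +m-+n≮0 e≤v v-e<0

ν≡⇒νfrac≡-1 : ∀ {p e} n k → ν p (suc k) ≡ fin (suc e) → ν p n ≡ fin e →
              νfrac p n (suc k) ≡ fin -[1+ 0 ]
ν≡⇒νfrac≡-1 {p} {e} (suc n) k νk≡1+e νn≡e =
  trans (νfrac≡ p n k νn≡e νk≡1+e) (cong fin (+m-+[1+m]≡-1 e))

Exceptional : ℕ → ℕ → ℕ → Set
Exceptional p k n = (suc k ≡ 4 ⊎ suc k ≡ p) × suc k ∣ n

p^e∣nP′k : ∀ {p k} e n → 2 ≤ p → suc k ≡ p ^ suc e → p ^ e ∣ n P′ k
p^e∣nP′k {p} {k} e n 2≤p k+1≡p^[1+e] = ∣1+k∧≢⇒∣nP′k n k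
  (subst (p ^ e ∣_) (sym k+1≡p^[1+e]) (n∣m*n p))
  (<⇒≢ (subst (p ^ e <_) (sym k+1≡p^[1+e]) (^-monoʳ-< p 2≤p (n<1+n e))))

p^e∤nP′k⇒p∣1+n : ∀ {p k} e n → Prime p → suc k ≡ p ^ e → ¬ p ^ e ∣ n P′ k → p ∣ suc n
p^e∤nP′k⇒p∣1+n {p} {k} e n pp k+1≡p^e p^e∤X = decidable-stable (p ∣? suc n) λ p∤1+n →
  p^e∤X (p^e∣m*n∧p∤m⇒p^e∣n e _ pp p∤1+n (subst (_∣ suc n * (n P′ k)) k+1≡p^e (1+k∣[1+n]*nP′k n k)))

p^[1+e]∤nP′k⇒exceptional : ∀ {p k} e n → Prime p → suc k ≡ p ^ suc e →
                           ¬ p ^ suc e ∣ n P′ k → Exceptional p k (suc n)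
p^[1+e]∤nP′k⇒exceptional e n pp k+1≡p^[1+e] p^[1+e]∤X
  with p^e∤nP′k⇒p∣1+n (suc e) n pp k+1≡p^[1+e] p^[1+e]∤X
p^[1+e]∤nP′k⇒exceptional {p} zero n _ k+1≡p^1 _ | p∣1+n =
  inj₂ k+1≡p , subst (_∣ suc n) (sym k+1≡p) p∣1+n
  where k+1≡p = trans k+1≡p^1 (*-identityʳ p)
p^[1+e]∤nP′k⇒exceptional {p} {k} 1 n pp k+1≡p^2 p²∤X | p∣1+n with p ≟ 2
... | yes refl with suc-injective k+1≡p^2
...   | refl with 2∣1+n⇒4∣1+n⊎4∣nP′3 n p∣1+n
...     | inj₁ 4∣1+n = inj₁ refl , 4∣1+n
...     | inj₂ 4∣X   = contradiction 4∣X p²∤X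
p^[1+e]∤nP′k⇒exceptional {p} {k} 1 n pp k+1≡p^2 p²∤X | _ | no p≢2 =
  contradiction (∣k!⇒∣nP′k n k (p^[1+e]∣k! 2≤p k+1≡p^2 3≤p^1)) p²∤X
  where
  2≤p = prime>1 pp
  3≤p^1 : 3 ≤ p ^ 1
  3≤p^1 = subst (3 ≤_) (sym (*-identityʳ p)) (≤∧≢⇒< 2≤p (p≢2 ∘ sym))
p^[1+e]∤nP′k⇒exceptional {p} {k} (suc (suc t)) n pp k+1≡p^[1+e] p^[1+e]∤X | _ =
  contradiction (∣k!⇒∣nP′k n k (p^[1+e]∣k! 2≤p k+1≡p^[1+e] 2+e≤p^e)) p^[1+e]∤X
  where
  2≤p = prime>1 pp
  2+e≤p^e = ≤-trans (2+n≤2^n (2 + t) (s≤s (s≤s z≤n))) (^-monoˡ-≤ (2 + t) 2≤p)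

exceptional⇒p^[1+e]∤nP′k : ∀ {p e k} n → Prime p → p ∣ suc k → ν p (suc k) ≡ fin (suc e) →
                           Exceptional p k (suc n) → ¬ p ^ suc e ∣ n P′ k
exceptional⇒p^[1+e]∤nP′k {p} {e} n pp _ _ (inj₂ k+1≡p , k+1∣1+n) =
  p∤nP′[p∸1] n pp k+1≡p (subst (_∣ suc n) k+1≡p k+1∣1+n) ∘ ∣-trans (m∣m*n (p ^ e))
exceptional⇒p^[1+e]∤nP′k {p} n pp p∣k+1 νk≡1+e (inj₁ k+1≡4 , k+1∣1+n)
  with suc-injective k+1≡4 | p≡2
  where
  p≡2 : p ≡ 2
  p≡2 = ≤-antisym (∣⇒≤ (reduce (euclidsLemma 2 2 pp (subst (p ∣_) k+1≡4 p∣k+1)))) (prime>1 pp)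
... | refl | refl with νk≡1+e
...   | refl = 4∣1+n⇒4∤nP′3 n k+1∣1+n

lemma1 : (k n p e : ℕ) → 1 ≤ k → 1 ≤ n → Prime p → p ∣ suc k →
           ν p (suc k) ≡ fin e → 1 ≤ e →
           ((suc k ≢ p ^ e → fin e ≤∞ ν p ((n ∸ 1) P k))
           × (suc k ≡ p ^ e →
               (fin (e ∸ 1) ≤∞ ν p ((n ∸ 1) P k))
               × (ν p ((n ∸ 1) P k) ≡ fin (e ∸ 1) → p ∣ n))
           × ((νfrac p ((n ∸ 1) P k) (suc k) <ℤ∞ fin (+ 0))
               ⇔ ((suc k ≡ 4 ⊎ suc k ≡ p) × suc k ∣ n))
           × (νfrac p ((n ∸ 1) P k) (suc k) <ℤ∞ fin (+ 0) →
               νfrac p ((n ∸ 1) P k) (suc k) ≡ fin -[1+ 0 ]))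
lemma1 k zero    p e       _ () _ _ _ _
lemma1 k (suc n) p zero    _ _ _ _ _ ()
lemma1 k (suc n) p (suc e) _ _ pp p∣k+1 νk≡1+e _ rewrite nPk≡nP′k n k =
  (λ k+1≢p^[1+e] → from (≤ν⇔^∣ 2≤p (suc e) X) (∣1+k∧≢⇒∣nP′k n k p^[1+e]∣k+1 (k+1≢p^[1+e] ∘ sym)))
  , (λ k+1≡p^[1+e] → from (≤ν⇔^∣ 2≤p e X) (p^e∣nP′k e n 2≤p k+1≡p^[1+e])
                   , p^e∤nP′k⇒p∣1+n (suc e) n pp k+1≡p^[1+e] ∘ proj₂ ∘ to (ν≡fin⇔ 2≤p e X))
  , mk⇔ (λ neg → p^[1+e]∤nP′k⇒exceptional e n pp (k+1≡p^[1+e] (p^[1+e]∤X neg)) (p^[1+e]∤X neg))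
        (λ exc → subst (_<ℤ∞ fin (+ 0))
                   (sym (νfrac≡-1 (exceptional⇒p^[1+e]∤nP′k n pp p∣k+1 νk≡1+e exc)))
                   (fin<fin ℤ.-<+))
  , νfrac≡-1 ∘ p^[1+e]∤X
  where
  2≤p = prime>1 pp
  X = n P′ k
  p^[1+e]∣k+1 : p ^ suc e ∣ suc k
  p^[1+e]∣k+1 = proj₁ (to (ν≡fin⇔ 2≤p (suc e) (suc k)) νk≡1+e)
  k+1≡p^[1+e] : ¬ p ^ suc e ∣ X → suc k ≡ p ^ suc e
  k+1≡p^[1+e] = sym ∘ ∣1+k∧∤nP′k⇒≡1+k n p^[1+e]∣k+1
  p^[1+e]∤X : νfrac p X (suc k) <ℤ∞ fin (+ 0) → ¬ p ^ suc e ∣ X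
  p^[1+e]∤X = νfrac<0⇒¬^∣ X k 2≤p νk≡1+e
  νfrac≡-1 : ¬ p ^ suc e ∣ X → νfrac p X (suc k) ≡ fin -[1+ 0 ]
  νfrac≡-1 p^[1+e]∤X = ν≡⇒νfrac≡-1 X k νk≡1+e
    (from (ν≡fin⇔ 2≤p e X) (p^e∣nP′k e n 2≤p (k+1≡p^[1+e] p^[1+e]∤X) , p^[1+e]∤X))
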